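{- For all $n\ge1$, the chromatic number of the parity-constrained Hanoi graph is $\chi(P^n)=3$.
   Context: Let $Q=\{0,1,2,3\}$ (pegs: $0,3$ neutral; $1$ reserved for even discs; $2$ reserved for odd discs). For a disc $d\in\{1,\dots,n\}$ let $p(d)=1$ if $d$ is even and $p(d)=2$ if $d$ is odd, and $Q^d=\{0,p(d),3\}$. The vertices of $P^n$ are words $s=s_n\cdots s_1\in Q^n$ ($s_d$ is the peg of disc $d$) with $s_d\in Q^d$ for all $d$. Two vertices are adjacent iff they differ in exactly one coordinate $d$, with values $i\ne j$ there, $i,j\in Q^d$, and $s_k\notin\{i,j\}$ for all $k<d$. -}

module Defs where

open import Data.Nat using (ℕ; zero; suc; _<_)
open import Data.Fin using (Fin; toℕ)
open import Data.Product using (Σ; ∃; _×_; proj₁)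
open import Data.Sum using (_⊎_)
open import Relation.Binary.PropositionalEquality using (_≡_; _≢_)
open import Relation.Nullary using (¬_)

Peg : Set
Peg = Fin 4

-- Discs are 1..n; disc d is represented by i : Fin n with d = suc (toℕ i).
disc : {n : ℕ} → Fin n → ℕ
disc i = suc (toℕ i)

p : ℕ → ℕ
p zero = 1
p (suc zero) = 2
p (suc (suc d)) = p d

Allowed : ℕ → Peg → Set
Allowed d q = (toℕ q ≡ 0) ⊎ (toℕ q ≡ p d) ⊎ (toℕ q ≡ 3)

-- Vertices of P^n: words s = s_n ⋯ s_1, given as s : Fin n → Peg
-- (s i is the peg of disc (disc i)), with s_d ∈ Q^d for all d.
Vertex : ℕ → Set
Vertex n = Σ (Fin n → Peg) λ s → ∀ i → Allowed (disc i) (s i)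

word : {n : ℕ} → Vertex n → Fin n → Peg
word = proj₁

-- Adjacency: differ in exactly one coordinate d (values i ≠ j there),
-- and every smaller disc k < d lies on neither peg i nor peg j.
-- (i, j ∈ Q^d holds automatically since both words are vertices.)
Adjacent : {n : ℕ} → Vertex n → Vertex n → Set
Adjacent {n} u v =
  ∃ λ (d : Fin n) →
    (word u d ≢ word v d)
    × (∀ (k : Fin n) → k ≢ d → word u k ≡ word v k)
    × (∀ (k : Fin n) → toℕ k < toℕ d → (word u k ≢ word u d) × (word u k ≢ word v d))

Colourable : ℕ → ℕ → Set
Colourable n m = ∃ λ (c : Vertex n → Fin m) → ∀ u v → Adjacent u v → c u ≢ c v

ChromaticNumber : ℕ → ℕ → Set
ChromaticNumber n k = Colourable n k × (∀ m → m < k → ¬ Colourable n m)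

-- Colour a configuration by the sum modulo 3 of its discs' peg classes, where
-- pegs 1 and 2 form one class: they never both lie in the same Q^d, so moving
-- a single disc always changes its class and hence the sum.  Conversely the
-- three configurations that differ only in the position of disc 1 (on peg 0,
-- 2 or 3) form a triangle, so two colours never suffice.
module Submission where

open import Defs
open import Algebra.Core using (Op₂)
open import Data.Fin using (Fin; zero; suc; toℕ; punchIn; _<_)
open import Data.Fin.Patterns using (0F; 1F; 2F; 3F)
open import Data.Fin.Properties using (suc-injective; toℕ-injective; punchIn-injective; pigeonhole; <⇒≢)
open import Data.Nat using (ℕ; _≥_)
import Data.Nat as ℕ
open import Data.Product using (_,_; proj₂)
open import Data.Sum using (inj₁; inj₂)
open import Data.Vec.Functional using (Vector; foldr)
open import Function using (_∘_)
open import Relation.Binary.PropositionalEquality using (_≡_; _≢_; refl; sym; trans; cong; cong₂)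
open import Relation.Nullary using (¬_; contradiction)

module _ {a} {A : Set a} {_∙_ : Op₂ A} {ε : A} where

  open import Algebra.Definitions (_≡_ {A = A}) using (LeftCancellative; RightCancellative)

  foldr-cong : ∀ {n} {xs ys : Vector A n} → (∀ k → xs k ≡ ys k) →
               foldr _∙_ ε xs ≡ foldr _∙_ ε ys
  foldr-cong {ℕ.zero}  _     = refl
  foldr-cong {ℕ.suc n} xs≗ys = cong₂ _∙_ (xs≗ys zero) (foldr-cong (xs≗ys ∘ suc))

  foldr-≢-at : LeftCancellative _∙_ → RightCancellative _∙_ →
               ∀ {n} {xs ys : Vector A n} d → xs d ≢ ys d → (∀ k → k ≢ d → xs k ≡ ys k) →
               foldr _∙_ ε xs ≢ foldr _∙_ ε ys
  foldr-≢-at cancelˡ cancelʳ zero xs₀≢ys₀ agree eq =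
    xs₀≢ys₀ (cancelʳ _ _ _ (trans eq (cong (_ ∙_) (sym (foldr-cong (λ k → agree (suc k) λ ()))))))
  foldr-≢-at cancelˡ cancelʳ (suc d) xsd≢ysd agree eq =
    foldr-≢-at cancelˡ cancelʳ d xsd≢ysd (λ k k≢d → agree (suc k) (k≢d ∘ suc-injective))
      (cancelˡ _ _ _ (trans (cong (_∙ _) (sym (agree zero λ ()))) eq))

rotate rotate⁻¹ : Fin 3 → Fin 3
rotate 0F = 1F
rotate 1F = 2F
rotate 2F = 0F
rotate⁻¹ 0F = 2F
rotate⁻¹ 1F = 0F
rotate⁻¹ 2F = 1F

rotate⁻¹-rotate : ∀ x → rotate⁻¹ (rotate x) ≡ x
rotate⁻¹-rotate 0F = refl
rotate⁻¹-rotate 1F = refl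
rotate⁻¹-rotate 2F = refl

rotate-injective : ∀ {x y} → rotate x ≡ rotate y → x ≡ y
rotate-injective {x} {y} eq =
  trans (sym (rotate⁻¹-rotate x)) (trans (cong rotate⁻¹ eq) (rotate⁻¹-rotate y))

infixl 6 _⊕_

_⊕_ : Op₂ (Fin 3)
0F ⊕ y = y
1F ⊕ y = rotate y
2F ⊕ y = rotate (rotate y)

⊕-comm : ∀ x y → x ⊕ y ≡ y ⊕ x
⊕-comm 0F 0F = refl
⊕-comm 0F 1F = refl
⊕-comm 0F 2F = refl
⊕-comm 1F 0F = refl
⊕-comm 1F 1F = refl
⊕-comm 1F 2F = refl
⊕-comm 2F 0F = refl
⊕-comm 2F 1F = refl
⊕-comm 2F 2F = refl

⊕-cancelˡ : ∀ x y z → x ⊕ y ≡ x ⊕ z → y ≡ z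
⊕-cancelˡ 0F _ _ = λ eq → eq
⊕-cancelˡ 1F _ _ = rotate-injective
⊕-cancelˡ 2F _ _ = rotate-injective ∘ rotate-injective

⊕-cancelʳ : ∀ x y z → y ⊕ x ≡ z ⊕ x → y ≡ z
⊕-cancelʳ x y z eq = ⊕-cancelˡ x y z (trans (⊕-comm x y) (trans eq (⊕-comm z x)))

pegClass : Peg → Fin 3
pegClass 0F = 0F
pegClass 1F = 1F
pegClass 2F = 1F
pegClass 3F = 2F

classPeg : ℕ → Fin 3 → ℕ
classPeg d 0F = 0
classPeg d 1F = p d
classPeg d 2F = 3

classPeg-pegClass : ∀ {d x} → Allowed d x → classPeg d (pegClass x) ≡ toℕ x
classPeg-pegClass {x = 0F} _                   = refl
classPeg-pegClass {x = 1F} (inj₂ (inj₁ 1≡pd))  = sym 1≡pd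
classPeg-pegClass {x = 1F} (inj₁ ())
classPeg-pegClass {x = 1F} (inj₂ (inj₂ ()))
classPeg-pegClass {x = 2F} (inj₂ (inj₁ 2≡pd))  = sym 2≡pd
classPeg-pegClass {x = 2F} (inj₁ ())
classPeg-pegClass {x = 2F} (inj₂ (inj₂ ()))
classPeg-pegClass {x = 3F} _                   = refl

pegClass-injectiveOn-Allowed : ∀ {d x y} → Allowed d x → Allowed d y →
                               pegClass x ≡ pegClass y → x ≡ y
pegClass-injectiveOn-Allowed {d} ax ay eq = toℕ-injective
  (trans (sym (classPeg-pegClass ax)) (trans (cong (classPeg d) eq) (classPeg-pegClass ay)))

colour : ∀ {n} → Vertex n → Fin 3
colour u = foldr _⊕_ 0F (pegClass ∘ word u)

colour-proper : ∀ {n} (u v : Vertex n) → Adjacent u v → colour u ≢ colour v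
colour-proper u v (d , ud≢vd , agree , _) = foldr-≢-at ⊕-cancelˡ ⊕-cancelʳ d
  (ud≢vd ∘ pegClass-injectiveOn-Allowed {disc d} (proj₂ u d) (proj₂ v d))
  (λ k k≢d → cong pegClass (agree k k≢d))

colourable-3 : ∀ n → Colourable n 3
colourable-3 n = colour , colour-proper

clique⇒¬Colourable : ∀ {n k m} (K : Fin k → Vertex n) →
                     (∀ {i j} → i < j → Adjacent (K i) (K j)) → m ℕ.< k → ¬ Colourable n m
clique⇒¬Colourable K adjacent m<k (c , proper) with pigeonhole m<k (c ∘ K)
... | i , j , i<j , same = proper (K i) (K j) (adjacent i<j) same

disc1On : ∀ {n} (q : Peg) → Allowed 1 q → Vertex (ℕ.suc n)
disc1On q aq = (λ { zero → q ; (suc _) → 0F }) , λ { zero → aq ; (suc _) → inj₁ refl }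

disc1On-adjacent : ∀ {n q r} (aq : Allowed 1 q) (ar : Allowed 1 r) → q ≢ r →
                   Adjacent (disc1On {n} q aq) (disc1On r ar)
disc1On-adjacent _ _ q≢r =
  zero , q≢r , (λ { zero 0≢0 → contradiction refl 0≢0 ; (suc _) _ → refl }) , λ _ ()

-- Disc 1 is odd, so it may use pegs 0, 2 and 3, i.e. every peg except 1.
disc1-allowed : (i : Fin 3) → Allowed 1 (punchIn 1F i)
disc1-allowed 0F = inj₁ refl
disc1-allowed 1F = inj₂ (inj₁ refl)
disc1-allowed 2F = inj₂ (inj₂ refl)

triangle : ∀ {n} → Fin 3 → Vertex (ℕ.suc n)
triangle i = disc1On (punchIn 1F i) (disc1-allowed i)

triangle-adjacent : ∀ {n} {i j : Fin 3} → i < j → Adjacent (triangle {n} i) (triangle j)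
triangle-adjacent {i = i} {j} i<j =
  disc1On-adjacent (disc1-allowed i) (disc1-allowed j) (<⇒≢ i<j ∘ punchIn-injective 1F i j)

theorem6p23 : ∀ (n : ℕ) → n ≥ 1 → ChromaticNumber n 3
theorem6p23 (ℕ.suc n) _ =
  colourable-3 (ℕ.suc n) , λ _ m<3 → clique⇒¬Colourable triangle triangle-adjacent m<3
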